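{- Let $G$ be a minimal counterexample (as defined in the context). Then $G$ contains no cycle consisting of $3$-paths, i.e. there are no $k\geq 1$ and vertices $v_0,v_4,\dots,v_{4(k-1)}$ together with $3$-paths $v_{4i}v_{4i+1}v_{4i+2}v_{4i+3}v_{4(i+1)}$ ($0\leq i\leq k-1$, indices of the form $v_{4k}=v_0$) whose union is a cycle of $G$.
   Context: A $2$-distance $k$-coloring of a graph assigns colors from $\{1,\dots,k\}$ so that distinct vertices at distance at most $2$ get different colors. A minimal counterexample is a finite simple graph $G$ with $\mathrm{mad}(G)\leq 18/7$ (equivalently $9|A|-7|E(G[A])|\geq 0$ for all $A\subseteq V(G)$), maximum degree $\Delta(G)=7$, that has no $2$-distance $8$-coloring, and such that every graph $H$ with $\mathrm{mad}(H)\leq 18/7$, maximum degree at most $7$ and $|V(H)|+|E(H)|<|V(G)|+|E(G)|$ has a $2$-distance $8$-coloring. A $3$-path is a walk $x_0x_1x_2x_3x_4$ in which $x_1,x_2,x_3$ are distinct vertices of degree $2$ in $G$. -}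

module Defs where

open import Data.Nat using (ℕ; zero; suc; _+_; _*_; _≤_; _<_; _<ᵇ_; _%_)
open import Data.Bool using (Bool; true; false; if_then_else_; _∧_)
open import Data.Fin using (Fin; toℕ)
open import Data.Fin.Subset using (Subset; ⊤; ∣_∣)
open import Data.Vec using (lookup)
open import Data.List using (List; map; allFin)
open import Data.Nat.ListAction using (sum)
open import Data.Product using (Σ; ∃; _×_; _,_)
open import Relation.Binary.PropositionalEquality using (_≡_; _≢_)
open import Relation.Nullary using (¬_)
open import Data.Sum using (_⊎_)

record Graph : Set where
  field
    n      : ℕ
    adj    : Fin n → Fin n → Bool
    symm   : ∀ u v → adj u v ≡ adj v u
    irrefl : ∀ u → adj u u ≡ false
open Graph public

Vertex : Graph → Set
Vertex G = Fin (n G)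

Adjacent : (G : Graph) → Vertex G → Vertex G → Set
Adjacent G u v = adj G u v ≡ true

deg : (G : Graph) → Vertex G → ℕ
deg G u = sum (map (λ v → if adj G u v then 1 else 0) (allFin (n G)))

edgesIn : (G : Graph) → Subset (n G) → ℕ
edgesIn G A =
  sum (map (λ u → sum (map (λ v →
      if (toℕ u <ᵇ toℕ v) ∧ lookup A u ∧ lookup A v ∧ adj G u v then 1 else 0)
      (allFin (n G)))) (allFin (n G)))

numEdges : Graph → ℕ
numEdges G = edgesIn G ⊤

MadAtMost18/7 : Graph → Set
MadAtMost18/7 G = ∀ (A : Subset (n G)) → 7 * edgesIn G A ≤ 9 * ∣ A ∣

MaxDegAtMost : Graph → ℕ → Set
MaxDegAtMost G d = ∀ (u : Vertex G) → deg G u ≤ d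

MaxDegEq : Graph → ℕ → Set
MaxDegEq G d = MaxDegAtMost G d × Σ (Vertex G) (λ u → deg G u ≡ d)

Dist≤2 : (G : Graph) → Vertex G → Vertex G → Set
Dist≤2 G u v = Adjacent G u v ⊎ Σ (Vertex G) (λ w → Adjacent G u w × Adjacent G w v)

TwoDistColoring : (G : Graph) → ℕ → Set
TwoDistColoring G k =
  Σ (Vertex G → Fin k) (λ c →
    ∀ (u v : Vertex G) → u ≢ v → Dist≤2 G u v → c u ≢ c v)

Minimality : Graph → Set
Minimality G = ∀ (H : Graph) → MadAtMost18/7 H → MaxDegAtMost H 7 →
  n H + numEdges H < n G + numEdges G → TwoDistColoring H 8

record MinimalCounterexample (G : Graph) : Set where
  field
    mad      : MadAtMost18/7 G
    maxDeg7  : MaxDegEq G 7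
    noColor  : ¬ TwoDistColoring G 8
    minimal  : Minimality G

-- A cycle of G consisting of k ≥ 1 three-paths: a closed walk
-- v 0, v 1, …, v (4k) = v 0 whose vertices v 0 … v (4k-1) are pairwise
-- distinct (so it is a cycle of length 4k), consecutive vertices adjacent,
-- and every v i with i not ≡ 0 mod 4 (the inner vertices of the 3-paths
-- v(4i) v(4i+1) v(4i+2) v(4i+3) v(4i+4)) has degree 2 in G.
CycleOf3Paths : (G : Graph) → (k : ℕ) → (ℕ → Vertex G) → Set
CycleOf3Paths G k v =
  (1 ≤ k) ×
  (v (4 * k) ≡ v 0) ×
  (∀ i → i < 4 * k → Adjacent G (v i) (v (suc i))) ×
  (∀ i j → i < 4 * k → j < 4 * k → i ≢ j → v i ≢ v j) ×
  (∀ i → i < 4 * k → i % 4 ≢ 0 → deg G (v i) ≡ 2)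

-- Delete the edges at the middle vertices of all the 3-paths. The resulting
-- graph H is smaller, still has mad ≤ 18/7 and Δ ≤ 7, and so has a 2-distance
-- 8-colouring. In H the two cycle neighbours of each branch vertex are pendant
-- twins, so their colours may be exchanged independently; a cyclic choice of
-- these exchanges gives the first and last inner vertex of every 3-path
-- distinct colours. Each middle vertex then sees only four coloured vertices
-- within distance 2 and takes a fifth colour, which 2-distance 8-colours G.

module Submission where

open import Data.Bool using (Bool; true; false; if_then_else_; _∧_; not)
open import Data.Bool.Properties using (if-float; ∧-comm; ∧-zeroʳ; T-≡) renaming (_≟_ to _≟ᵇ_)
open import Data.Empty using (⊥-elim)
open import Data.Fin using (Fin; toℕ) renaming (zero to fzero; suc to fsuc)
open import Data.Fin.Properties using (_≟_; any?; all?; ¬∀⟶∃¬; injective⇒≤; toℕ-injective)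
open import Data.Fin.Subset using (⊤)
open import Data.List using (List; []; _∷_; map; allFin; tabulate)
open import Data.List.Membership.Propositional using (_∈_)
open import Data.List.Membership.Propositional.Properties using (∈-allFin)
open import Data.List.Properties using (map-tabulate)
open import Data.List.Relation.Unary.Any using (here; there)
open import Data.Nat using (ℕ; zero; suc; _+_; _*_; _∸_; _%_; _≤_; _<_; z≤n; s≤s; z<s; s<s; _<ᵇ_)
open import Data.Nat.DivMod using ([m+kn]%n≡m%n; m<n⇒m%n≡m)
open import Data.Nat.ListAction using (sum)
open import Data.Nat.Properties
  using ( ≤-refl; ≤-reflexive; ≤-trans; <-trans; ≤-<-trans; <-irrefl; <-cmp; <⇒≱; ≤∧≮⇒≡; n<1+n
        ; m<n⇒m<1+n; m<m+n; <⇒<ᵇ; _<?_; anyUpTo?; suc-injective; +-comm; +-suc; +-identityʳ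
        ; +-cancelˡ-≡; *-comm; +-mono-≤; +-mono-<-≤; +-mono-≤-<; +-monoʳ-<; *-monoʳ-≤; *-monoˡ-≤
        ; m∸n+n≡m; +-commutativeSemigroup; module ≤-Reasoning)
  renaming (_≟_ to _≟ℕ_)
open import Algebra.Properties.CommutativeSemigroup +-commutativeSemigroup using (interchange)
open import Data.Product using (Σ; ∃; _×_; _,_; proj₁; proj₂)
open import Data.Sum using (_⊎_; inj₁; inj₂)
open import Data.Vec using (lookup; []; _∷_)
open import Data.Vec.Properties using (lookup-replicate)
open import Function using (_∘_)
open import Function.Bundles using (Equivalence)
open import Relation.Binary.Definitions using (Tri; tri<; tri≈; tri>; DecidableEquality)
open import Relation.Binary.PropositionalEquality
open import Relation.Nullary using (¬_; Dec; yes; no; does; ¬?; _×-dec_)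
open import Relation.Nullary.Decidable using (decidable-stable)

open import Defs

ind : Bool → ℕ
ind b = if b then 1 else 0

sum-map-mono : ∀ {A : Set} (xs : List A) {f g : A → ℕ} → (∀ x → f x ≤ g x) →
  sum (map f xs) ≤ sum (map g xs)
sum-map-mono []       f≤g = z≤n
sum-map-mono (x ∷ xs) f≤g = +-mono-≤ (f≤g x) (sum-map-mono xs f≤g)

sum-map-mono-< : ∀ {A : Set} (xs : List A) {f g : A → ℕ} → (∀ x → f x ≤ g x) →
  ∀ {a} → a ∈ xs → f a < g a → sum (map f xs) < sum (map g xs)
sum-map-mono-< (x ∷ xs) f≤g (here refl) fa<ga = +-mono-<-≤ fa<ga (sum-map-mono xs f≤g)
sum-map-mono-< (x ∷ xs) f≤g (there a∈xs) fa<ga = +-mono-≤-< (f≤g x) (sum-map-mono-< xs f≤g a∈xs fa<ga)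

sum-map-+ : ∀ {A : Set} (xs : List A) (f g : A → ℕ) →
  sum (map (λ x → f x + g x) xs) ≡ sum (map f xs) + sum (map g xs)
sum-map-+ []       f g = refl
sum-map-+ (x ∷ xs) f g =
  trans (cong (f x + g x +_) (sum-map-+ xs f g)) (interchange (f x) (g x) _ _)

sum-zeros : ∀ n → sum (tabulate {n = n} (λ _ → 0)) ≡ 0
sum-zeros zero    = refl
sum-zeros (suc n) = sum-zeros n

δ : ∀ {n} → Fin n → Fin n → ℕ
δ a y = ind (does (y ≟ a))

sum-δ : ∀ {n} (a : Fin n) → sum (map (δ a) (allFin n)) ≡ 1
sum-δ {n} a = trans (cong sum (map-tabulate {n = n} (λ y → y) (δ a))) (go a)
  where
  go : ∀ {n} (a : Fin n) → sum (tabulate (δ a)) ≡ 1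
  go {suc n} fzero    = cong suc (sum-zeros n)
  go {suc n} (fsuc a) = go a

three-distinct≤sum : ∀ {n} (P : Fin n → Bool) {a b c : Fin n} → a ≢ b → a ≢ c → b ≢ c →
  P a ≡ true → P b ≡ true → P c ≡ true → 3 ≤ sum (map (λ y → ind (P y)) (allFin n))
three-distinct≤sum {n} P {a} {b} {c} a≢b a≢c b≢c Pa Pb Pc =
  subst (_≤ sum (map (λ y → ind (P y)) (allFin n))) sum-three (sum-map-mono (allFin n) pointwise)
  where
  sum-three : sum (map (λ y → δ a y + δ b y + δ c y) (allFin n)) ≡ 3
  sum-three = begin
    sum (map (λ y → δ a y + δ b y + δ c y) (allFin n))
      ≡⟨ sum-map-+ (allFin n) (λ y → δ a y + δ b y) (δ c) ⟩
    sum (map (λ y → δ a y + δ b y) (allFin n)) + sum (map (δ c) (allFin n))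
      ≡⟨ cong (_+ sum (map (δ c) (allFin n))) (sum-map-+ (allFin n) (δ a) (δ b)) ⟩
    sum (map (δ a) (allFin n)) + sum (map (δ b) (allFin n)) + sum (map (δ c) (allFin n))
      ≡⟨ cong₂ _+_ (cong₂ _+_ (sum-δ a) (sum-δ b)) (sum-δ c) ⟩
    3 ∎
    where open ≡-Reasoning
  pointwise : ∀ y → δ a y + δ b y + δ c y ≤ ind (P y)
  pointwise y with y ≟ a | y ≟ b | y ≟ c
  ... | yes refl | yes refl | _        = ⊥-elim (a≢b refl)
  ... | yes refl | _        | yes refl = ⊥-elim (a≢c refl)
  ... | _        | yes refl | yes refl = ⊥-elim (b≢c refl)
  ... | yes refl | no _     | no _     = ≤-reflexive (cong ind (sym Pa))
  ... | no _     | yes refl | no _     = ≤-reflexive (cong ind (sym Pb))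
  ... | no _     | no _     | yes refl = ≤-reflexive (cong ind (sym Pc))
  ... | no _     | no _     | no _     = z≤n

Adjacent-sym : (G : Graph) {u y : Vertex G} → Adjacent G u y → Adjacent G y u
Adjacent-sym G {u} {y} u~y = trans (symm G y u) u~y

Adjacent-irrefl : (G : Graph) {u : Vertex G} → ¬ Adjacent G u u
Adjacent-irrefl G {u} u~u with trans (sym (irrefl G u)) u~u
... | ()

Dist≤2-sym : (G : Graph) {u y : Vertex G} → Dist≤2 G u y → Dist≤2 G y u
Dist≤2-sym G (inj₁ u~y)            = inj₁ (Adjacent-sym G u~y)
Dist≤2-sym G (inj₂ (w , u~w , w~y)) = inj₂ (w , Adjacent-sym G w~y , Adjacent-sym G u~w)

degree-two-neighbours : (G : Graph) {u a b : Vertex G} → deg G u ≡ 2 →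
  Adjacent G u a → Adjacent G u b → a ≢ b → ∀ {y} → Adjacent G u y → y ≡ a ⊎ y ≡ b
degree-two-neighbours G {u} {a} {b} deg≡2 u~a u~b a≢b {y} u~y with y ≟ a | y ≟ b
... | yes y≡a | _        = inj₁ y≡a
... | no _    | yes y≡b  = inj₂ y≡b
... | no y≢a  | no y≢b   = ⊥-elim (<⇒≱ (n<1+n 2)
  (subst (3 ≤_) deg≡2 (three-distinct≤sum (adj G u) a≢b (y≢a ∘ sym) (y≢b ∘ sym) u~a u~b u~y)))

ind-∧ˡ : ∀ x e → ind (x ∧ e) ≤ ind x
ind-∧ˡ true  true  = ≤-refl
ind-∧ˡ true  false = z≤n
ind-∧ˡ false _     = ≤-refl

ind-∧-last : ∀ a b c d e → ind (a ∧ b ∧ c ∧ (d ∧ e)) ≤ ind (a ∧ b ∧ c ∧ d)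
ind-∧-last true  true  true  d e = ind-∧ˡ d e
ind-∧-last true  true  false _ _ = z≤n
ind-∧-last true  false _     _ _ = z≤n
ind-∧-last false _     _     _ _ = z≤n

module Isolate (G : Graph) {S : Vertex G → Set} (S? : ∀ u → Dec (S u)) where

  outside : Vertex G → Bool
  outside u = not (does (S? u))

  isolate : Graph
  isolate = record
    { n      = n G
    ; adj    = λ u y → adj G u y ∧ (outside u ∧ outside y)
    ; symm   = λ u y → cong₂ _∧_ (symm G u y) (∧-comm (outside u) (outside y))
    ; irrefl = λ u → cong (_∧ (outside u ∧ outside u)) (irrefl G u)
    }

  outside⁺ : ∀ {u} → ¬ S u → outside u ≡ true
  outside⁺ {u} ¬Su with S? u
  ... | yes Su = ⊥-elim (¬Su Su)
  ... | no _   = refl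

  outside⁻ : ∀ {u} → outside u ≡ true → ¬ S u
  outside⁻ {u} out with S? u
  outside⁻ () | yes _
  ... | no ¬Su = ¬Su

  isolate-adjacent⁺ : ∀ {u y} → Adjacent G u y → ¬ S u → ¬ S y → Adjacent isolate u y
  isolate-adjacent⁺ u~y ¬Su ¬Sy rewrite u~y | outside⁺ ¬Su | outside⁺ ¬Sy = refl

  isolate-adjacent⁻ : ∀ {u y} → Adjacent isolate u y → Adjacent G u y × ¬ S u × ¬ S y
  isolate-adjacent⁻ {u} {y} u~y with adj G u y | outside u in out-u | outside y in out-y
  isolate-adjacent⁻ refl | true | true | true = refl , outside⁻ out-u , outside⁻ out-y

  isolate-edgesIn : ∀ A → edgesIn isolate A ≤ edgesIn G A
  isolate-edgesIn A = sum-map-mono (allFin (n G)) λ u → sum-map-mono (allFin (n G)) λ y →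
    ind-∧-last (toℕ u <ᵇ toℕ y) (lookup A u) (lookup A y) (adj G u y) (outside u ∧ outside y)

  isolate-mad : MadAtMost18/7 G → MadAtMost18/7 isolate
  isolate-mad mad A = ≤-trans (*-monoʳ-≤ 7 (isolate-edgesIn A)) (mad A)

  isolate-maxDeg : ∀ {d} → MaxDegAtMost G d → MaxDegAtMost isolate d
  isolate-maxDeg maxDeg u =
    ≤-trans (sum-map-mono (allFin (n G)) λ y → ind-∧ˡ (adj G u y) (outside u ∧ outside y)) (maxDeg u)

  private
    lost-edge : ∀ {a b} → toℕ a < toℕ b → Adjacent G a b → adj isolate a b ≡ false →
      numEdges isolate < numEdges G
    lost-edge {a} {b} a<b a~b lost =
      sum-map-mono-< (allFin (n G)) (λ u → sum-map-mono (allFin (n G)) (summand-≤ u)) (∈-allFin a)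
        (sum-map-mono-< (allFin (n G)) (summand-≤ a) (∈-allFin b) summand-<)
      where
      summand-≤ : ∀ u y → ind ((toℕ u <ᵇ toℕ y) ∧ lookup ⊤ u ∧ lookup ⊤ y ∧ adj isolate u y)
                        ≤ ind ((toℕ u <ᵇ toℕ y) ∧ lookup ⊤ u ∧ lookup ⊤ y ∧ adj G u y)
      summand-≤ u y = ind-∧-last (toℕ u <ᵇ toℕ y) (lookup ⊤ u) (lookup ⊤ y) (adj G u y) (outside u ∧ outside y)
      summand-< : ind ((toℕ a <ᵇ toℕ b) ∧ lookup ⊤ a ∧ lookup ⊤ b ∧ adj isolate a b)
                < ind ((toℕ a <ᵇ toℕ b) ∧ lookup ⊤ a ∧ lookup ⊤ b ∧ adj G a b)
      summand-< rewrite Equivalence.to T-≡ (<⇒<ᵇ a<b)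
                      | lookup-replicate a true | lookup-replicate b true | a~b | lost = s≤s z≤n

  isolate-smaller : ∀ {a b} → Adjacent G a b → S a → n isolate + numEdges isolate < n G + numEdges G
  isolate-smaller {a} {b} a~b Sa = +-monoʳ-< (n G) (edge-count (<-cmp (toℕ a) (toℕ b)))
    where
    lost : adj isolate a b ≡ false
    lost with S? a
    ... | yes _  = ∧-zeroʳ (adj G a b)
    ... | no ¬Sa = ⊥-elim (¬Sa Sa)
    edge-count : Tri (toℕ a < toℕ b) (toℕ a ≡ toℕ b) (toℕ b < toℕ a) → numEdges isolate < numEdges G
    edge-count (tri< a<b _ _) = lost-edge a<b a~b lost
    edge-count (tri≈ _ a≡b _) with toℕ-injective a≡b
    ... | refl = ⊥-elim (Adjacent-irrefl G a~b)
    edge-count (tri> _ _ b<a) = lost-edge b<a (Adjacent-sym G a~b) (trans (symm isolate b a) lost)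

colouring-∘-embedding : (H : Graph) {m : ℕ} (φ : Vertex H → Vertex H) →
  (∀ {u y} → φ u ≡ φ y → u ≡ y) → (∀ {u y} → Adjacent H u y → Adjacent H (φ u) (φ y)) →
  TwoDistColoring H m → TwoDistColoring H m
colouring-∘-embedding H φ φ-injective φ-adjacent (c , c-proper) = c ∘ φ , proper
  where
  proper : ∀ u y → u ≢ y → Dist≤2 H u y → c (φ u) ≢ c (φ y)
  proper u y u≢y (inj₁ u~y) = c-proper (φ u) (φ y) (u≢y ∘ φ-injective) (inj₁ (φ-adjacent u~y))
  proper u y u≢y (inj₂ (w , u~w , w~y)) =
    c-proper (φ u) (φ y) (u≢y ∘ φ-injective) (inj₂ (φ w , φ-adjacent u~w , φ-adjacent w~y))

twin-map-adjacent : (H : Graph) (φ : Vertex H → Vertex H) →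
  (∀ {u y} → Adjacent H u y → Adjacent H (φ u) y) →
  (∀ {u y} → Adjacent H u y → φ u ≢ u → φ y ≡ y) →
  ∀ {u y} → Adjacent H u y → Adjacent H (φ u) (φ y)
twin-map-adjacent H φ φ-twin φ-fixes {u} {y} u~y with φ u ≟ u
... | yes φu≡u = subst (λ x → Adjacent H x (φ y)) (sym φu≡u) (Adjacent-sym H (φ-twin (Adjacent-sym H u~y)))
... | no φu≢u  = subst (Adjacent H (φ u)) (sym (φ-fixes u~y φu≢u)) (φ-twin u~y)

module PairSwap {V : Set} (_≟ᵥ_ : DecidableEquality V) (k : ℕ) (a b : ℕ → V)
  (a-injective : ∀ {i j} → i < k → j < k → a i ≡ a j → i ≡ j)
  (b-injective : ∀ {i j} → i < k → j < k → b i ≡ b j → i ≡ j)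
  (a≢b : ∀ {i j} → i < k → j < k → a i ≢ b j)
  (s : ℕ → Bool) where

  swap : V → V
  swap u with anyUpTo? (λ j → a j ≟ᵥ u) k | anyUpTo? (λ j → b j ≟ᵥ u) k
  ... | yes (j , _ , _) | _               = if s j then b j else a j
  ... | no _            | yes (j , _ , _) = if s j then a j else b j
  ... | no _            | no _            = u

  swap-a : ∀ {j} → j < k → swap (a j) ≡ (if s j then b j else a j)
  swap-a {j} j<k with anyUpTo? (λ i → a i ≟ᵥ a j) k | anyUpTo? (λ i → b i ≟ᵥ a j) k
  ... | yes (i , i<k , ai≡aj) | _ with a-injective i<k j<k ai≡aj
  ...   | refl = refl
  swap-a {j} j<k | no none | _ = ⊥-elim (none (j , j<k , refl))

  swap-b : ∀ {j} → j < k → swap (b j) ≡ (if s j then a j else b j)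
  swap-b {j} j<k with anyUpTo? (λ i → a i ≟ᵥ b j) k | anyUpTo? (λ i → b i ≟ᵥ b j) k
  ... | yes (i , i<k , ai≡bj) | _ = ⊥-elim (a≢b i<k j<k ai≡bj)
  ... | no _ | yes (i , i<k , bi≡bj) with b-injective i<k j<k bi≡bj
  ...   | refl = refl
  swap-b {j} j<k | no _ | no none = ⊥-elim (none (j , j<k , refl))

  swap-fixed : ∀ {u} → (∀ {j} → j < k → u ≢ a j × u ≢ b j) → swap u ≡ u
  swap-fixed {u} outside with anyUpTo? (λ j → a j ≟ᵥ u) k | anyUpTo? (λ j → b j ≟ᵥ u) k
  ... | yes (j , j<k , aj≡u) | _                    = ⊥-elim (proj₁ (outside j<k) (sym aj≡u))
  ... | no _                 | yes (j , j<k , bj≡u) = ⊥-elim (proj₂ (outside j<k) (sym bj≡u))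
  ... | no _                 | no _                 = refl

  swap-cases : ∀ u → (Σ ℕ λ j → j < k × (u ≡ a j ⊎ u ≡ b j)) ⊎ swap u ≡ u
  swap-cases u with anyUpTo? (λ j → a j ≟ᵥ u) k | anyUpTo? (λ j → b j ≟ᵥ u) k
  ... | yes (j , j<k , aj≡u) | _                    = inj₁ (j , j<k , inj₁ (sym aj≡u))
  ... | no _                 | yes (j , j<k , bj≡u) = inj₁ (j , j<k , inj₂ (sym bj≡u))
  ... | no _                 | no _                 = inj₂ refl

  swap-involutive : ∀ u → swap (swap u) ≡ u
  swap-involutive u with swap-cases u
  ... | inj₂ fixed = trans (cong swap fixed) fixed
  ... | inj₁ (j , j<k , inj₁ refl) rewrite swap-a j<k with s j in sj
  ...   | true  = trans (swap-b j<k) (cong (if_then a j else b j) sj)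
  ...   | false = trans (swap-a j<k) (cong (if_then b j else a j) sj)
  swap-involutive u | inj₁ (j , j<k , inj₂ refl) rewrite swap-b j<k with s j in sj
  ...   | true  = trans (swap-a j<k) (cong (if_then b j else a j) sj)
  ...   | false = trans (swap-b j<k) (cong (if_then a j else b j) sj)

module TwinSwap (H : Graph) (k : ℕ) (a b : ℕ → Vertex H)
  (a-injective : ∀ {i j} → i < k → j < k → a i ≡ a j → i ≡ j)
  (b-injective : ∀ {i j} → i < k → j < k → b i ≡ b j → i ≡ j)
  (a≢b : ∀ {i j} → i < k → j < k → a i ≢ b j)
  (twin-ab : ∀ {j y} → j < k → Adjacent H (a j) y → Adjacent H (b j) y)
  (twin-ba : ∀ {j y} → j < k → Adjacent H (b j) y → Adjacent H (a j) y)
  (neighbours-unpaired : ∀ {i j y} → i < k → j < k → Adjacent H (a j) y → y ≢ a i × y ≢ b i)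
  (s : ℕ → Bool) where

  open PairSwap _≟_ k a b a-injective b-injective a≢b s public

  swap-twin : ∀ {u y} → Adjacent H u y → Adjacent H (swap u) y
  swap-twin {u} u~y with swap-cases u
  ... | inj₂ fixed = subst (λ x → Adjacent H x _) (sym fixed) u~y
  ... | inj₁ (j , j<k , inj₁ refl) rewrite swap-a j<k with s j
  ...   | true  = twin-ab j<k u~y
  ...   | false = u~y
  swap-twin {u} u~y | inj₁ (j , j<k , inj₂ refl) rewrite swap-b j<k with s j
  ...   | true  = twin-ba j<k u~y
  ...   | false = u~y

  swap-fixes-neighbours : ∀ {u y} → Adjacent H u y → swap u ≢ u → swap y ≡ y
  swap-fixes-neighbours {u} u~y moved with swap-cases u
  ... | inj₂ fixed = ⊥-elim (moved fixed)
  ... | inj₁ (j , j<k , inj₁ refl) = swap-fixed (λ i<k → neighbours-unpaired i<k j<k u~y)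
  ... | inj₁ (j , j<k , inj₂ refl) = swap-fixed (λ i<k → neighbours-unpaired i<k j<k (twin-ba j<k u~y))

  swap-colouring : ∀ {m} → TwoDistColoring H m → TwoDistColoring H m
  swap-colouring = colouring-∘-embedding H swap swap-injective
    (twin-map-adjacent H swap swap-twin swap-fixes-neighbours)
    where
    swap-injective : ∀ {u y} → swap u ≡ swap y → u ≡ y
    swap-injective {u} {y} e = trans (sym (swap-involutive u)) (trans (cong swap e) (swap-involutive y))

  swap-colouring-a : ∀ {m} (c : TwoDistColoring H m) {j} → j < k →
    proj₁ (swap-colouring c) (a j) ≡ proj₁ c (if s j then b j else a j)
  swap-colouring-a c j<k = cong (proj₁ c) (swap-a j<k)

  swap-colouring-b : ∀ {m} (c : TwoDistColoring H m) {j} → j < k →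
    proj₁ (swap-colouring c) (b j) ≡ proj₁ c (if s j then a j else b j)
  swap-colouring-b c j<k = cong (proj₁ c) (swap-b j<k)

fresh-colour : ∀ {n m} → n < m → (f : Fin n → Fin m) → ∃ λ e → ∀ i → f i ≢ e
fresh-colour {n} {m} n<m f with any? (λ e → all? (λ i → ¬? (f i ≟ e)))
... | yes missed = missed
... | no none    = ⊥-elim (<⇒≱ n<m (injective⇒≤ preimage-injective))
  where
  hit : ∀ e → ∃ λ i → f i ≡ e
  hit e with ¬∀⟶∃¬ n _ (λ i → ¬? (f i ≟ e)) (λ missed → none (e , missed))
  ... | i , ¬fi≢e = i , decidable-stable (f i ≟ e) ¬fi≢e
  preimage-injective : ∀ {e e'} → proj₁ (hit e) ≡ proj₁ (hit e') → e ≡ e'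
  preimage-injective {e} {e'} eq = trans (sym (proj₂ (hit e))) (trans (cong f eq) (proj₂ (hit e')))

extend-colouring : (G : Graph) {m n : ℕ} → n < m → {S : Vertex G → Set} → (∀ u → Dec (S u)) →
  (c : Vertex G → Fin m) → (∀ u y → ¬ S u → ¬ S y → u ≢ y → Dist≤2 G u y → c u ≢ c y) →
  (∀ u → S u → Σ (Fin n → Vertex G) λ N →
     (∀ i → ¬ S (N i)) × (∀ y → y ≢ u → Dist≤2 G u y → ∃ λ i → N i ≡ y)) →
  TwoDistColoring G m
extend-colouring G n<m {S} S? c c-proper ball = (λ u → colour u (S? u)) , proper
  where
  colour : ∀ u → Dec (S u) → Fin _
  colour u (yes Su) = proj₁ (fresh-colour n<m (c ∘ proj₁ (ball u Su)))
  colour u (no _)   = c u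
  fresh-proper : ∀ u y (Su : S u) → u ≢ y → Dist≤2 G u y → (dy : Dec (S y)) →
    colour u (yes Su) ≢ colour y dy
  fresh-proper u y Su u≢y d dy with ball u Su | fresh-colour n<m (c ∘ proj₁ (ball u Su))
  ... | N , N-outside , N-covers | e , e-fresh with N-covers y (u≢y ∘ sym) d | dy
  ...   | i , refl | yes Sy = ⊥-elim (N-outside i Sy)
  ...   | i , refl | no _   = e-fresh i ∘ sym
  proper : ∀ u y → u ≢ y → Dist≤2 G u y → colour u (S? u) ≢ colour y (S? y)
  proper u y u≢y d with S? u | S? y
  ... | yes Su | dy = fresh-proper u y Su u≢y d dy
  ... | no ¬Su | yes Sy = fresh-proper y u Sy (u≢y ∘ sym) (Dist≤2-sym G d) (no ¬Su) ∘ sym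
  ... | no ¬Su | no ¬Sy = c-proper u y ¬Su ¬Sy u≢y d

next : ℕ → ℕ → ℕ
next k i with suc i <? k
... | yes _ = suc i
... | no _  = 0

next-cases : ∀ {k i} → i < k → (suc i < k × next k i ≡ suc i) ⊎ (suc i ≡ k × next k i ≡ 0)
next-cases {k} {i} i<k with suc i <? k
... | yes si<k = inj₁ (si<k , refl)
... | no si≮k  = inj₂ (≤∧≮⇒≡ i<k si≮k , refl)

next-< : ∀ {k i} → i < k → next k i < k
next-< i<k with next-cases i<k
... | inj₁ (si<k , eq) = subst (_< _) (sym eq) si<k
... | inj₂ (_ , eq)    = subst (_< _) (sym eq) (≤-<-trans z≤n i<k)

next-injective : ∀ {k i j} → i < k → j < k → next k i ≡ next k j → i ≡ j
next-injective i<k j<k eq with next-cases i<k | next-cases j<k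
... | inj₁ (_ , ei) | inj₁ (_ , ej) = suc-injective (trans (sym ei) (trans eq ej))
... | inj₂ (ki , _) | inj₂ (kj , _) = suc-injective (trans ki (sym kj))
... | inj₁ (_ , ei) | inj₂ (_ , ej) with trans (sym ei) (trans eq ej)
...   | ()
next-injective i<k j<k eq | inj₂ (_ , ei) | inj₁ (_ , ej) with trans (sym ej) (trans (sym eq) ei)
...   | ()

next-surjective : ∀ {k i} → i < k → ∃ λ j → j < k × next k j ≡ i
next-surjective {suc k′} {zero} _ with next-cases {suc k′} {k′} ≤-refl
... | inj₁ (k<k , _) = ⊥-elim (<-irrefl refl k<k)
... | inj₂ (_ , eq)  = k′ , ≤-refl , eq
next-surjective {k} {suc i} si<k with next-cases {k} {i} (<-trans (n<1+n i) si<k)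
... | inj₁ (_ , eq) = i , <-trans (n<1+n i) si<k , eq
... | inj₂ (k≡si , _) = ⊥-elim (<-irrefl k≡si si<k)

module CyclicOrientation {A : Set} (_≟ₐ_ : DecidableEquality A) (k : ℕ) (x y : ℕ → A)
  (x≢y : ∀ {j} → j < k → x j ≢ y j) where

  right left : Bool → ℕ → A
  right s j = if s then x j else y j
  left  s j = if s then y j else x j

  Compatible : ℕ → Bool → Bool → Set
  Compatible j a b = right a j ≢ left b (next k j)

  Orientation : (ℕ → Bool) → Set
  Orientation s = ∀ j → j < k → Compatible j (s j) (s (next k j))

  Universal : ℕ → Bool → Set
  Universal j b = Compatible j true b × Compatible j false b

  universal? : ∀ j b → Dec (Universal j b)
  universal? j b = ¬? (right true j ≟ₐ left b (next k j)) ×-dec ¬? (right false j ≟ₐ left b (next k j))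

  -- At a universal position the step ignores its input, so all runs merge there.
  step : ℕ → Bool → Bool
  step j a with universal? j true | universal? j false
  ... | yes _ | _     = true
  ... | no _  | yes _ = false
  ... | no _  | no _  = does (right a j ≟ₐ x (next k j))

  step-compatible : ∀ {j} → j < k → ∀ a → Compatible j a (step j a)
  step-compatible {j} j<k a with universal? j true | universal? j false
  ... | yes (c-true , c-false) | _ = universal-at a
    where
    universal-at : ∀ a → Compatible j a true
    universal-at true  = c-true
    universal-at false = c-false
  ... | no _ | yes (c-true , c-false) = universal-at a
    where
    universal-at : ∀ a → Compatible j a false
    universal-at true  = c-true
    universal-at false = c-false
  ... | no _ | no _ with right a j ≟ₐ x (next k j)
  ...   | yes r≡x = λ r≡y → x≢y (next-< j<k) (trans (sym r≡x) r≡y)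
  ...   | no r≢x  = r≢x

  step-constant : ∀ {j b} → Universal j b → ∀ a a′ → step j a ≡ step j a′
  step-constant {j} {b} u a a′ with universal? j true | universal? j false
  ... | yes _ | _     = refl
  ... | no _  | yes _ = refl
  step-constant {j} {true}  u a a′ | no ¬u | no _  = ⊥-elim (¬u u)
  step-constant {j} {false} u a a′ | no _  | no ¬u = ⊥-elim (¬u u)

  run : Bool → ℕ → Bool
  run a zero    = a
  run a (suc t) = step t (run a t)

  run-orientation : ∀ {a} → run a k ≡ a → Orientation (run a)
  run-orientation {a} closed j j<k with next-cases j<k
  ... | inj₁ (_ , eq) = subst (λ i → Compatible j (run a j) (run a i)) (sym eq) (step-compatible j<k (run a j))
  ... | inj₂ (sj≡k , eq) = subst (λ i → Compatible j (run a j) (run a i)) (sym eq)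
    (subst (Compatible j (run a j)) (trans (cong (run a) sj≡k) closed) (step-compatible j<k (run a j)))

  run-agree : ∀ {a a′ t} → run a t ≡ run a′ t → ∀ m → run a (m + t) ≡ run a′ (m + t)
  run-agree agree zero    = agree
  run-agree agree (suc m) = cong (step (m + _)) (run-agree agree m)

  universal-run-agree : ∀ {d b} → d < k → Universal d b → ∀ a a′ → run a k ≡ run a′ k
  universal-run-agree {d} d<k u a a′ =
    subst (λ t → run a t ≡ run a′ t) (m∸n+n≡m d<k)
      (run-agree (step-constant u (run a d) (run a′ d)) (k ∸ suc d))

  InPair : ℕ → A → Set
  InPair j z = z ≡ x j ⊎ z ≡ y j

  non-universal-in-pair : ∀ {j b} → ¬ Universal j b → InPair j (left b (next k j))
  non-universal-in-pair {j} {b} ¬u with right true j ≟ₐ left b (next k j) | right false j ≟ₐ left b (next k j)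
  ... | yes x≡l     | _           = inj₁ (sym x≡l)
  ... | no _        | yes y≡l     = inj₂ (sym y≡l)
  ... | no c-true   | no c-false  = ⊥-elim (¬u (c-true , c-false))

  pairs-within-first : (∀ {d b} → d < k → ¬ Universal d b) → ∀ {j} → j < k → InPair 0 (x j) × InPair 0 (y j)
  pairs-within-first none {zero}  _    = inj₁ refl , inj₂ refl
  pairs-within-first none {suc j} sj<k with next-cases {k} {j} (<-trans (n<1+n j) sj<k)
  ... | inj₂ (sj≡k , _) = ⊥-elim (<-irrefl sj≡k sj<k)
  ... | inj₁ (_ , eq) =
    into-first (subst (λ i → InPair j (x i)) eq (non-universal-in-pair (none j<k))) ,
    into-first (subst (λ i → InPair j (y i)) eq (non-universal-in-pair (none j<k)))
    where
    j<k = <-trans (n<1+n j) sj<k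
    into-first : ∀ {z} → InPair j z → InPair 0 z
    into-first (inj₁ refl) = proj₁ (pairs-within-first none j<k)
    into-first (inj₂ refl) = proj₂ (pairs-within-first none j<k)

  orient-towards : ∀ {p q a b : A} → p ≢ q → (p ≡ a ⊎ p ≡ b) → (q ≡ a ⊎ q ≡ b) →
    (if does (p ≟ₐ a) then p else q) ≡ a × (if does (p ≟ₐ a) then q else p) ≡ b
  orient-towards {p} {q} {a} p≢q p∈ q∈ with p ≟ₐ a | p∈ | q∈
  ... | yes p≡a | _        | inj₁ q≡a = ⊥-elim (p≢q (trans p≡a (sym q≡a)))
  ... | yes p≡a | _        | inj₂ q≡b = p≡a , q≡b
  ... | no p≢a  | inj₁ p≡a | _        = ⊥-elim (p≢a p≡a)
  ... | no _    | inj₂ p≡b | inj₁ q≡a = q≡a , p≡b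
  ... | no _    | inj₂ p≡b | inj₂ q≡b = ⊥-elim (p≢q (trans p≡b (sym q≡b)))

  constant-orientation : (∀ {d b} → d < k → ¬ Universal d b) → Orientation (λ j → does (x j ≟ₐ x 0))
  constant-orientation none j j<k r≡l = x≢y (≤-<-trans z≤n j<k) (begin
    x 0                                                ≡⟨ proj₁ (oriented j<k) ⟨
    right (does (x j ≟ₐ x 0)) j                        ≡⟨ r≡l ⟩
    left (does (x (next k j) ≟ₐ x 0)) (next k j)       ≡⟨ proj₂ (oriented (next-< j<k)) ⟩
    y 0                                                ∎)
    where
    open ≡-Reasoning
    oriented : ∀ {i} → i < k → right (does (x i ≟ₐ x 0)) i ≡ x 0 × left (does (x i ≟ₐ x 0)) i ≡ y 0
    oriented i<k = orient-towards (x≢y i<k) (proj₁ (pairs-within-first none i<k)) (proj₂ (pairs-within-first none i<k))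

  -- If the greedy runs from both start values end equal, their common end value
  -- closes the cycle; otherwise no position is universal, and then every pair
  -- equals the first one as a set.
  orientation : Σ (ℕ → Bool) Orientation
  orientation with run true k ≟ᵇ run false k
  ... | yes agree = run (run true k) , run-orientation (runs-agree (run true k))
    where
    runs-agree : ∀ c → run c k ≡ run true k
    runs-agree true  = refl
    runs-agree false = sym agree
  ... | no differ = _ , constant-orientation (λ d<k u → differ (universal-run-agree d<k u true false))

0<3 : 0 < 3
0<3 = z<s
1<3 : 1 < 3
1<3 = s<s z<s
2<3 : 2 < 3
2<3 = s<s (s<s z<s)
0<4 : 0 < 4
0<4 = z<s
1<4 : 1 < 4
1<4 = s<s z<s
2<4 : 2 < 4
2<4 = s<s (s<s z<s)
3<4 : 3 < 4
3<4 = s<s (s<s (s<s z<s))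

index-injective : ∀ i j {r s} → r < 4 → s < 4 → i * 4 + r ≡ j * 4 + s → i ≡ j × r ≡ s
index-injective zero    zero    _   _   eq   = refl , eq
index-injective zero    (suc j) r<4 _   refl = ⊥-elim (<⇒≱ r<4 (s≤s (s≤s (s≤s (s≤s z≤n)))))
index-injective (suc i) zero    _   s<4 refl = ⊥-elim (<⇒≱ s<4 (s≤s (s≤s (s≤s (s≤s z≤n)))))
index-injective (suc i) (suc j) r<4 s<4 eq with index-injective i j r<4 s<4 (+-cancelˡ-≡ 4 _ _ eq)
... | refl , r≡s = refl , r≡s

index-< : ∀ {i k r} → i < k → r < 4 → i * 4 + r < 4 * k
index-< {i} {k} {r} i<k r<4 = begin-strict
  i * 4 + r  <⟨ +-monoʳ-< (i * 4) r<4 ⟩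
  i * 4 + 4  ≡⟨ +-comm (i * 4) 4 ⟩
  suc i * 4  ≤⟨ *-monoˡ-≤ 4 i<k ⟩
  k * 4      ≡⟨ *-comm k 4 ⟩
  4 * k      ∎
  where open ≤-Reasoning

-- V i r is the r-th vertex of the i-th 3-path, whose last vertex is branch i.
module ThreePathCycle (G : Graph) {k : ℕ} {v : ℕ → Vertex G} (cyc : CycleOf3Paths G k v) where

  private
    closes : v (4 * k) ≡ v 0
    closes = proj₁ (proj₂ cyc)

    consecutive-adjacent : ∀ i → i < 4 * k → Adjacent G (v i) (v (suc i))
    consecutive-adjacent = proj₁ (proj₂ (proj₂ cyc))

    distinct : ∀ i j → i < 4 * k → j < 4 * k → i ≢ j → v i ≢ v j
    distinct = proj₁ (proj₂ (proj₂ (proj₂ cyc)))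

    inner-degree : ∀ i → i < 4 * k → i % 4 ≢ 0 → deg G (v i) ≡ 2
    inner-degree = proj₂ (proj₂ (proj₂ (proj₂ cyc)))

  V : ℕ → ℕ → Vertex G
  V i r = v (i * 4 + r)

  branch : ℕ → Vertex G
  branch i = V (next k i) 0

  V-injective : ∀ {i j r s} → i < k → j < k → r < 4 → s < 4 → V i r ≡ V j s → i ≡ j × r ≡ s
  V-injective {i} {j} {r} {s} i<k j<k r<4 s<4 eq with i * 4 + r ≟ℕ j * 4 + s
  ... | yes same  = index-injective i j r<4 s<4 same
  ... | no differ = ⊥-elim (distinct _ _ (index-< i<k r<4) (index-< j<k s<4) differ eq)

  V-distinct : ∀ {i j r s} → i < k → j < k → r < 4 → s < 4 → r ≢ s → V i r ≢ V j s
  V-distinct i<k j<k r<4 s<4 r≢s = r≢s ∘ proj₂ ∘ V-injective i<k j<k r<4 s<4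

  V-adjacent : ∀ {i r} → i < k → r < 3 → Adjacent G (V i r) (V i (suc r))
  V-adjacent {i} {r} i<k r<3 = subst (Adjacent G (V i r) ∘ v) (sym (+-suc (i * 4) r))
    (consecutive-adjacent (i * 4 + r) (index-< i<k (m<n⇒m<1+n r<3)))

  end-is-branch : ∀ {i} → i < k → v (i * 4 + 4) ≡ branch i
  end-is-branch {i} i<k with next-cases i<k
  ... | inj₁ (_ , eq) rewrite eq = cong v (trans (+-comm (i * 4) 4) (sym (+-identityʳ (suc i * 4))))
  ... | inj₂ (si≡k , eq) rewrite eq =
    trans (cong v (trans (+-comm (i * 4) 4) (trans (cong (_* 4) si≡k) (*-comm k 4)))) closes

  V-adjacent-branch : ∀ {i} → i < k → Adjacent G (V i 3) (branch i)
  V-adjacent-branch {i} i<k =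
    subst (Adjacent G (V i 3)) (trans (cong v (sym (+-suc (i * 4) 3))) (end-is-branch i<k))
      (consecutive-adjacent (i * 4 + 3) (index-< i<k 3<4))

  V-degree : ∀ {i r} → i < k → r ≢ 0 → r < 4 → deg G (V i r) ≡ 2
  V-degree {i} {r} i<k r≢0 r<4 = inner-degree (i * 4 + r) (index-< i<k r<4) λ eq → r≢0 (begin
    r                ≡⟨ m<n⇒m%n≡m r<4 ⟨
    r % 4            ≡⟨ [m+kn]%n≡m%n r i 4 ⟨
    (r + i * 4) % 4  ≡⟨ cong (_% 4) (+-comm r (i * 4)) ⟩
    (i * 4 + r) % 4  ≡⟨ eq ⟩
    0                ∎)
    where open ≡-Reasoning

  neighbours-V1 : ∀ {i y} → i < k → Adjacent G (V i 1) y → y ≡ V i 0 ⊎ y ≡ V i 2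
  neighbours-V1 i<k = degree-two-neighbours G (V-degree i<k (λ ()) 1<4)
    (Adjacent-sym G (V-adjacent i<k 0<3)) (V-adjacent i<k 1<3) (V-distinct i<k i<k 0<4 2<4 λ ())

  neighbours-V2 : ∀ {i y} → i < k → Adjacent G (V i 2) y → y ≡ V i 1 ⊎ y ≡ V i 3
  neighbours-V2 i<k = degree-two-neighbours G (V-degree i<k (λ ()) 2<4)
    (Adjacent-sym G (V-adjacent i<k 1<3)) (V-adjacent i<k 2<3) (V-distinct i<k i<k 1<4 3<4 λ ())

  neighbours-V3 : ∀ {i y} → i < k → Adjacent G (V i 3) y → y ≡ V i 2 ⊎ y ≡ branch i
  neighbours-V3 i<k = degree-two-neighbours G (V-degree i<k (λ ()) 3<4)
    (Adjacent-sym G (V-adjacent i<k 2<3)) (V-adjacent-branch i<k) (V-distinct i<k (next-< i<k) 2<4 0<4 λ ())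

module Reduction (G : Graph) (mc : MinimalCounterexample G) {k : ℕ} {v : ℕ → Vertex G}
  (cyc : CycleOf3Paths G k v) where

  open MinimalCounterexample mc
  open ThreePathCycle G cyc

  0<k : 0 < k
  0<k = proj₁ cyc

  Middle : Vertex G → Set
  Middle u = ∃ λ i → i < k × V i 2 ≡ u

  middle? : ∀ u → Dec (Middle u)
  middle? u = anyUpTo? (λ i → V i 2 ≟ u) k

  V-not-middle : ∀ {i r} → i < k → r < 4 → r ≢ 2 → ¬ Middle (V i r)
  V-not-middle i<k r<4 r≢2 (j , j<k , eq) = V-distinct j<k i<k 2<4 r<4 (r≢2 ∘ sym) eq

  open Isolate G middle?

  H-colouring : TwoDistColoring isolate 8
  H-colouring = minimal isolate (isolate-mad mad) (isolate-maxDeg (proj₁ maxDeg7))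
    (isolate-smaller (Adjacent-sym G (V-adjacent 0<k 1<3)) (0 , 0<k , refl))

  c : Vertex G → Fin 8
  c = proj₁ H-colouring

  -- In H the last inner vertex of the j-th 3-path and the first inner vertex of
  -- the next one are pendant vertices hanging at branch j.
  Q P : ℕ → Vertex G
  Q j = V j 3
  P j = V (next k j) 1

  Q-branch : ∀ {j} → j < k → Adjacent isolate (Q j) (branch j)
  Q-branch j<k = isolate-adjacent⁺ (V-adjacent-branch j<k) (V-not-middle j<k 3<4 λ ()) (V-not-middle (next-< j<k) 0<4 λ ())

  P-branch : ∀ {j} → j < k → Adjacent isolate (P j) (branch j)
  P-branch j<k = isolate-adjacent⁺ (Adjacent-sym G (V-adjacent (next-< j<k) 0<3))
    (V-not-middle (next-< j<k) 1<4 λ ()) (V-not-middle (next-< j<k) 0<4 λ ())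

  Q-pendant : ∀ {j y} → j < k → Adjacent isolate (Q j) y → y ≡ branch j
  Q-pendant j<k Qj~y with isolate-adjacent⁻ Qj~y
  ... | Qj~y′ , _ , ¬My with neighbours-V3 j<k Qj~y′
  ...   | inj₁ y≡M = ⊥-elim (¬My (_ , j<k , sym y≡M))
  ...   | inj₂ y≡branch = y≡branch

  P-pendant : ∀ {j y} → j < k → Adjacent isolate (P j) y → y ≡ branch j
  P-pendant j<k Pj~y with isolate-adjacent⁻ Pj~y
  ... | Pj~y′ , _ , ¬My with neighbours-V1 (next-< j<k) Pj~y′
  ...   | inj₁ y≡branch = y≡branch
  ...   | inj₂ y≡M = ⊥-elim (¬My (_ , next-< j<k , sym y≡M))

  Q-injective : ∀ {i j} → i < k → j < k → Q i ≡ Q j → i ≡ j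
  Q-injective i<k j<k eq = proj₁ (V-injective i<k j<k 3<4 3<4 eq)

  P-injective : ∀ {i j} → i < k → j < k → P i ≡ P j → i ≡ j
  P-injective i<k j<k eq = next-injective i<k j<k (proj₁ (V-injective (next-< i<k) (next-< j<k) 1<4 1<4 eq))

  Q≢P : ∀ {i j} → i < k → j < k → Q i ≢ P j
  Q≢P i<k j<k = V-distinct i<k (next-< j<k) 3<4 1<4 λ ()

  branch-unpaired : ∀ {i j} → i < k → j < k → branch j ≢ Q i × branch j ≢ P i
  branch-unpaired i<k j<k = V-distinct (next-< j<k) i<k 0<4 3<4 (λ ())
                          , V-distinct (next-< j<k) (next-< i<k) 0<4 1<4 (λ ())

  Q-P-colours-differ : ∀ {j} → j < k → c (Q j) ≢ c (P j)
  Q-P-colours-differ {j} j<k = proj₂ H-colouring (Q j) (P j) (Q≢P j<k j<k) (inj₂ (_ , Q-branch j<k , Adjacent-sym isolate (P-branch j<k)))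

  twin-QP : ∀ {j y} → j < k → Adjacent isolate (Q j) y → Adjacent isolate (P j) y
  twin-QP {j} j<k Qj~y = subst (Adjacent isolate (P j)) (sym (Q-pendant j<k Qj~y)) (P-branch j<k)

  twin-PQ : ∀ {j y} → j < k → Adjacent isolate (P j) y → Adjacent isolate (Q j) y
  twin-PQ {j} j<k Pj~y = subst (Adjacent isolate (Q j)) (sym (P-pendant j<k Pj~y)) (Q-branch j<k)

  Q-neighbours-unpaired : ∀ {i j y} → i < k → j < k → Adjacent isolate (Q j) y → y ≢ Q i × y ≢ P i
  Q-neighbours-unpaired i<k j<k Qj~y rewrite Q-pendant j<k Qj~y = branch-unpaired i<k j<k

  open CyclicOrientation _≟_ k (c ∘ Q) (c ∘ P) Q-P-colours-differ using (Orientation; orientation; right; left)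

  -- Kept abstract: unfolding the orientation in later goals makes type checking very slow.
  abstract
    s : ℕ → Bool
    s = proj₁ orientation

    s-orientation : Orientation s
    s-orientation = proj₂ orientation

  open TwinSwap isolate k Q P Q-injective P-injective Q≢P twin-QP twin-PQ Q-neighbours-unpaired s
    using (swap-colouring; swap-colouring-a; swap-colouring-b)

  c′ : Vertex G → Fin 8
  c′ = proj₁ (swap-colouring H-colouring)

  c′-Q : ∀ {j} → j < k → c′ (Q j) ≡ left (s j) j
  c′-Q {j} j<k = trans (swap-colouring-a H-colouring j<k) (if-float c (s j))

  c′-P : ∀ {j} → j < k → c′ (P j) ≡ right (s j) j
  c′-P {j} j<k = trans (swap-colouring-b H-colouring j<k) (if-float c (s j))

  segment-ends-differ : ∀ {i} → i < k → c′ (V i 1) ≢ c′ (V i 3)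
  segment-ends-differ i<k with next-surjective i<k
  ... | j , j<k , refl = λ eq →
    s-orientation j j<k (trans (sym (c′-P j<k)) (trans eq (c′-Q (next-< j<k))))

  outside-middle-proper : ∀ u y → ¬ Middle u → ¬ Middle y → u ≢ y → Dist≤2 G u y → c′ u ≢ c′ y
  outside-middle-proper u y ¬Mu ¬My u≢y (inj₁ u~y) =
    proj₂ (swap-colouring H-colouring) u y u≢y (inj₁ (isolate-adjacent⁺ u~y ¬Mu ¬My))
  outside-middle-proper u y ¬Mu ¬My u≢y (inj₂ (w , u~w , w~y)) with middle? w
  ... | no ¬Mw = proj₂ (swap-colouring H-colouring) u y u≢y
    (inj₂ (w , isolate-adjacent⁺ u~w ¬Mu ¬Mw , isolate-adjacent⁺ w~y ¬Mw ¬My))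
  ... | yes (i , i<k , refl) with neighbours-V2 i<k (Adjacent-sym G u~w) | neighbours-V2 i<k w~y
  ...   | inj₁ refl | inj₁ refl = ⊥-elim (u≢y refl)
  ...   | inj₁ refl | inj₂ refl = segment-ends-differ i<k
  ...   | inj₂ refl | inj₁ refl = segment-ends-differ i<k ∘ sym
  ...   | inj₂ refl | inj₂ refl = ⊥-elim (u≢y refl)

  middle-ball : ∀ u → Middle u → Σ (Fin 4 → Vertex G) λ N →
    (∀ a → ¬ Middle (N a)) × (∀ y → y ≢ u → Dist≤2 G u y → ∃ λ a → N a ≡ y)
  middle-ball _ (i , i<k , refl) = N , N-outside , N-covers
    where
    N : Fin 4 → Vertex G
    N = lookup (V i 0 ∷ V i 1 ∷ V i 3 ∷ branch i ∷ [])
    N-outside : ∀ a → ¬ Middle (N a)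
    N-outside fzero                      = V-not-middle i<k 0<4 λ ()
    N-outside (fsuc fzero)               = V-not-middle i<k 1<4 λ ()
    N-outside (fsuc (fsuc fzero))        = V-not-middle i<k 3<4 λ ()
    N-outside (fsuc (fsuc (fsuc fzero))) = V-not-middle (next-< i<k) 0<4 λ ()
    N-covers : ∀ y → y ≢ V i 2 → Dist≤2 G (V i 2) y → ∃ λ a → N a ≡ y
    N-covers y y≢M (inj₁ M~y) with neighbours-V2 i<k M~y
    ... | inj₁ refl = fsuc fzero , refl
    ... | inj₂ refl = fsuc (fsuc fzero) , refl
    N-covers y y≢M (inj₂ (w , M~w , w~y)) with neighbours-V2 i<k M~w
    ... | inj₁ refl with neighbours-V1 i<k w~y
    ...   | inj₁ refl = fzero , refl
    ...   | inj₂ refl = ⊥-elim (y≢M refl)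
    N-covers y y≢M (inj₂ (w , M~w , w~y)) | inj₂ refl with neighbours-V3 i<k w~y
    ...   | inj₁ refl = ⊥-elim (y≢M refl)
    ...   | inj₂ refl = fsuc (fsuc (fsuc fzero)) , refl

  colouring : TwoDistColoring G 8
  colouring = extend-colouring G (m<m+n 4 z<s) middle? c′ outside-middle-proper middle-ball

lemma10 : (G : Graph) → MinimalCounterexample G →
    ¬ Σ ℕ (λ k → Σ (ℕ → Vertex G) (λ v → CycleOf3Paths G k v))
lemma10 G mc (k , v , cyc) = MinimalCounterexample.noColor mc (Reduction.colouring G mc cyc)
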